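{- Let $n=2k\ge6$ and let $\tilde{\mathbf{D}}_n$ be the simply-laced tree on vertices $0,1,\dots,n$ with edges $1-2$, $0-2$, $2-3,\dots,(n-3)-(n-2)$, $(n-2)-(n-1)$ and $(n-2)-n$. Then $\tilde{\mathbf{D}}_n$ has exactly $k+7=n/2+7$ equivalence classes of labelings.
   Context: Reeder's puzzle on a finite connected simple graph: a labeling assigns $a_j\in\mathbb{Z}/2\mathbb{Z}$ to each vertex $j$; the move $T_i$ replaces $a_i$ by $a_i+\sum_k a_k \pmod 2$ (sum over neighbors $k$ of $i$), other labels unchanged. Two labelings are equivalent if related by a finite sequence of moves. -}

module Defs where

open import Data.Nat using (ℕ; zero; suc; _+_; _*_; _∸_; _≤_)
open import Data.Nat.Properties using (_≟_; _≤?_)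
open import Data.Bool using (Bool; true; false; _∧_; _∨_; _xor_)
open import Data.Fin using (Fin; toℕ)
open import Data.Vec using (Vec; lookup; tabulate; foldr; updateAt)
open import Data.Product using (Σ; _×_)
open import Relation.Nullary using (¬_)
open import Relation.Nullary.Decidable using (⌊_⌋)
open import Relation.Binary.PropositionalEquality using (_≡_)
open import Relation.Binary.Construct.Closure.ReflexiveTransitive using (Star)

Graph : ℕ → Set
Graph m = Fin m → Fin m → Bool

-- Labelings: one element of ℤ/2ℤ (encoded as Bool, addition = xor) per vertex.
Labeling : ℕ → Set
Labeling m = Vec Bool m

neighbourSum : ∀ {m} → Graph m → Labeling m → Fin m → Bool
neighbourSum {m} G a i = foldr (λ _ → Bool) _xor_ false (tabulate (λ j → G i j ∧ lookup a j))

move : ∀ {m} → Graph m → Fin m → Labeling m → Labeling m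
move G i a = updateAt a i (λ x → x xor neighbourSum G a i)

Step : ∀ {m} → Graph m → Labeling m → Labeling m → Set
Step G a b = Σ _ (λ i → move G i a ≡ b)

Equiv : ∀ {m} → Graph m → Labeling m → Labeling m → Set
Equiv G = Star (Step G)

HasExactlyClasses : ∀ {m} → Graph m → ℕ → Set
HasExactlyClasses {m} G N =
  Σ (Fin N → Labeling m) (λ r →
    ((i j : Fin N) → Equiv G (r i) (r j) → i ≡ j) ×
    ((a : Labeling m) → Σ (Fin N) (λ i → Equiv G a (r i))))

edgeD : ℕ → ℕ → ℕ → Bool
edgeD n a b =
     (⌊ a ≟ 1 ⌋ ∧ ⌊ b ≟ 2 ⌋)
  ∨ (⌊ a ≟ 0 ⌋ ∧ ⌊ b ≟ 2 ⌋)
  ∨ (⌊ 2 ≤? a ⌋ ∧ ⌊ a ≤? n ∸ 3 ⌋ ∧ ⌊ b ≟ suc a ⌋)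
  ∨ (⌊ a ≟ n ∸ 2 ⌋ ∧ ⌊ b ≟ n ∸ 1 ⌋)
  ∨ (⌊ a ≟ n ∸ 2 ⌋ ∧ ⌊ b ≟ n ⌋)

Dtilde : (n : ℕ) → Graph (suc n)
Dtilde n i j = edgeD n (toℕ i) (toℕ j) ∨ edgeD n (toℕ j) (toℕ i)

-- Fold the label of the leaf 0 into vertex 1 and that of the leaf n into vertex n - 1: with
-- P(1) = a₀ + a₁, P(q) = a_q for 2 ≤ q ≤ n - 2, P(n - 1) = a_{n-1} + a_n and P(0) = P(n) = 0, a
-- labeling is determined by a₀, a_n and the word x_q = P(q) + P(q + 1) (q < n), and the words
-- that occur are exactly those with an even number w of ones. The move at a vertex transposes
-- two adjacent letters of x and changes neither a₀ nor a_n, except at the vertices 0 and n, where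
-- a₀ resp. a_n changes by the sum of the two letters. So w is invariant. If w = 0 or w = n every
-- move fixes the labeling, which gives 8 classes of one element. If 2 ≤ w ≤ n - 2, transpositions
-- reach every word with w ones, and a₀ and a_n can be cleared after making the relevant two
-- letters differ; this gives one class for each of the k - 1 values of w, k + 7 classes in all.
module Submission where

open import Defs
open import Algebra.Bundles using (CommutativeRing)
open import Data.Bool using (Bool; true; false; T; T?; _∧_; _∨_; _xor_; not)
open import Data.Bool.Properties
  using ( xor-∧-commutativeRing; xor-assoc; xor-comm; xor-identityʳ; xor-same
        ; ∧-assoc; ∧-zeroʳ; ∧-distribʳ-xor; ∧-distribˡ-xor; ∨-identityʳ; T-∧; T-∨ )
open import Data.Empty using (⊥; ⊥-elim)
open import Data.Fin using (Fin; toℕ; fromℕ<; fromℕ) renaming (zero to fzero; suc to fsuc)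
open import Data.Fin.Properties
  using (toℕ<n; toℕ-fromℕ<; toℕ-fromℕ; toℕ-injective; +↔⊎; *↔×; 2↔Bool)
open import Data.Nat
  using (ℕ; zero; suc; pred; _⊓_; _+_; _*_; _≤_; _<_; _≰_; _≡ᵇ_; _≤ᵇ_; _<ᵇ_; z≤n; s≤s; >-nonZero)
open import Data.Nat.Properties
  using ( _≟_; _≤?_; ≤-refl; ≤-reflexive; ≤-trans; ≤-antisym; <-trans; <-asym; <⇒≤; <⇒≢; >⇒≢
        ; <⇒≱; ≰⇒>; ≮⇒≥; ≤∧≢⇒<; ≤-pred; n≤1+n; n<1+n; m≤n+m; m≤n⇒m≤1+n; 0≢1+n; suc-injective
        ; pred-mono-≤; suc-pred; +-suc; +-comm; +-identityʳ
        ; +-monoʳ-≤; +-mono-≤; +-mono-<; +-mono-<-≤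
        ; m≤n⇒m⊓n≡m; m≥n⇒m⊓n≡n; ⊓-idem; m⊓n≤n )
open import Data.Product using (Σ; _×_; _,_; proj₁; proj₂; map; ∃-syntax)
open import Data.Product.Function.NonDependent.Propositional using (_×-↔_)
open import Data.Sum using (_⊎_; inj₁; inj₂)
open import Data.Sum.Function.Propositional using (_⊎-↔_)
open import Data.Vec using (Vec; []; _∷_; lookup; tabulate; foldr; updateAt; countᵇ)
open import Data.Vec.Properties using (count≤n)
open import Function using (_∘_; id)
open import Function.Bundles using (Equivalence; Inverse; _↔_)
open import Function.Properties.Inverse using (↔-refl; ↔-trans)
open import Relation.Binary.Construct.Closure.ReflexiveTransitive
  using (Star; ε; _◅_; _◅◅_; reverse)
open import Relation.Binary.PropositionalEquality
open import Relation.Nullary using (Dec; yes; no)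
open import Relation.Nullary.Decidable using (⌊_⌋; toWitness; dec-true; dec-false; isYes≗does)
open import Algebra.Properties.Group (CommutativeRing.+-group xor-∧-commutativeRing)
  using (∙-cancelˡ; ∙-cancelʳ)
open import Algebra.Properties.CommutativeSemigroup
  (CommutativeRing.+-commutativeSemigroup xor-∧-commutativeRing) using (interchange; x∙yz≈y∙xz)

-- at v q is false for q beyond the end of v.
at : ∀ {m} → Vec Bool m → ℕ → Bool
at []      _       = false
at (x ∷ _) zero    = x
at (_ ∷ v) (suc q) = at v q

tab : ∀ m → (ℕ → Bool) → Vec Bool m
tab zero    f = []
tab (suc m) f = f 0 ∷ tab m (f ∘ suc)

at-tab : ∀ {m} (f : ℕ → Bool) {q} → q < m → at (tab m f) q ≡ f q
at-tab f {zero}  (s≤s _)   = refl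
at-tab f {suc q} (s≤s q<m) = at-tab (f ∘ suc) q<m

tab-cong : ∀ m {f g : ℕ → Bool} → (∀ {q} → q < m → f q ≡ g q) → tab m f ≡ tab m g
tab-cong zero    f≗g = refl
tab-cong (suc m) f≗g = cong₂ _∷_ (f≗g (s≤s z≤n)) (tab-cong m (f≗g ∘ s≤s))

tab-at : ∀ {m} (v : Vec Bool m) → tab m (at v) ≡ v
tab-at []      = refl
tab-at (x ∷ v) = cong (x ∷_) (tab-at v)

at-injective : ∀ {m} {v w : Vec Bool m} → at v ≗ at w → v ≡ w
at-injective {m} {v} {w} v≗w =
  trans (sym (tab-at v)) (trans (tab-cong m (λ {q} _ → v≗w q)) (tab-at w))

at-≥ : ∀ {m} (v : Vec Bool m) {q} → m ≤ q → at v q ≡ false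
at-≥ []      _         = refl
at-≥ (_ ∷ v) (s≤s m≤q) = at-≥ v m≤q

lookup≡at : ∀ {m} (v : Vec Bool m) j → lookup v j ≡ at v (toℕ j)
lookup≡at (_ ∷ _) fzero    = refl
lookup≡at (_ ∷ v) (fsuc j) = lookup≡at v j

at-updateAt-xor : ∀ {m} (v : Vec Bool m) i d q →
                  at (updateAt v i (_xor d)) q ≡ at v q xor ((q ≡ᵇ toℕ i) ∧ d)
at-updateAt-xor (x ∷ v) fzero    d zero    = refl
at-updateAt-xor (x ∷ v) fzero    d (suc q) = sym (xor-identityʳ (at v q))
at-updateAt-xor (x ∷ v) (fsuc i) d zero    = sym (xor-identityʳ x)
at-updateAt-xor (x ∷ v) (fsuc i) d (suc q) = at-updateAt-xor v i d q

xor-cancelˡ : ∀ x y → x xor (x xor y) ≡ y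
xor-cancelˡ x y = trans (sym (xor-assoc x x y)) (cong (_xor y) (xor-same x))

xor-cancelʳ : ∀ x y → (x xor y) xor y ≡ x
xor-cancelʳ x y = trans (xor-assoc x y y) (trans (cong (x xor_) (xor-same y)) (xor-identityʳ x))

xor-cancel-middle : ∀ x y z → (x xor y) xor (y xor z) ≡ x xor z
xor-cancel-middle x y z = trans (xor-assoc x y (y xor z)) (cong (x xor_) (xor-cancelˡ y z))

∧-swapˡ : ∀ x y z → (x ∧ y) ∧ z ≡ y ∧ (x ∧ z)
∧-swapˡ true  y z = refl
∧-swapˡ false y z = sym (∧-zeroʳ y)

∨≡xor : ∀ {x y} → (T x → T y → ⊥) → x ∨ y ≡ x xor y
∨≡xor {true}  {true}  exclusive = ⊥-elim (exclusive _ _)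
∨≡xor {true}  {false} _         = refl
∨≡xor {false} {y}     _         = refl

∨-false≡xor-false : ∀ x → x ∨ false ≡ x xor false
∨-false≡xor-false x = trans (∨-identityʳ x) (sym (xor-identityʳ x))

T-∨-⊎ : ∀ x {y} → T (x ∨ y) → T x ⊎ T y
T-∨-⊎ x = Equivalence.to (T-∨ {x})

toWitness-∧ : ∀ {A B : Set} {a? : Dec A} {b? : Dec B} → T (⌊ a? ⌋ ∧ ⌊ b? ⌋) → A × B
toWitness-∧ {a? = a?} e = map toWitness toWitness (Equivalence.to (T-∧ {⌊ a? ⌋}) e)

≡ᵇ-true : ∀ {m n} → m ≡ n → (m ≡ᵇ n) ≡ true
≡ᵇ-true {m} {n} = dec-true (m ≟ n)

≡ᵇ-false : ∀ {m n} → m ≢ n → (m ≡ᵇ n) ≡ false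
≡ᵇ-false {m} {n} = dec-false (m ≟ n)

≤ᵇ-true : ∀ {m n} → m ≤ n → (m ≤ᵇ n) ≡ true
≤ᵇ-true {m} {n} = dec-true (m ≤? n)

≤ᵇ-false : ∀ {m n} → m ≰ n → (m ≤ᵇ n) ≡ false
≤ᵇ-false {m} {n} = dec-false (m ≤? n)

∨≡xor-δ : ∀ {u v} → u ≢ v → ∀ b → (b ≡ᵇ u) ∨ (b ≡ᵇ v) ≡ (b ≡ᵇ u) xor (b ≡ᵇ v)
∨≡xor-δ {u} {v} u≢v b with b ≟ u
... | yes refl rewrite ≡ᵇ-false u≢v = ∨-false≡xor-false (b ≡ᵇ b)
... | no  b≢u  rewrite ≡ᵇ-false b≢u = refl

xorSum : ℕ → (ℕ → Bool) → Bool
xorSum zero    f = false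
xorSum (suc m) f = f 0 xor xorSum m (f ∘ suc)

xorSum-cong : ∀ m {f g : ℕ → Bool} → f ≗ g → xorSum m f ≡ xorSum m g
xorSum-cong zero    f≗g = refl
xorSum-cong (suc m) f≗g = cong₂ _xor_ (f≗g 0) (xorSum-cong m (f≗g ∘ suc))

xorSum-false : ∀ m → xorSum m (λ _ → false) ≡ false
xorSum-false zero    = refl
xorSum-false (suc m) = xorSum-false m

xorSum-xor : ∀ m (f g : ℕ → Bool) → xorSum m (λ q → f q xor g q) ≡ xorSum m f xor xorSum m g
xorSum-xor zero    f g = refl
xorSum-xor (suc m) f g = trans (cong ((f 0 xor g 0) xor_) (xorSum-xor m (f ∘ suc) (g ∘ suc)))
                               (interchange (f 0) (g 0) _ _)

xorSum-∧ˡ : ∀ m c (f : ℕ → Bool) → xorSum m (λ q → c ∧ f q) ≡ c ∧ xorSum m f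
xorSum-∧ˡ m true  f = refl
xorSum-∧ˡ m false f = xorSum-false m

xorSum-∧-xor : ∀ m (f g h : ℕ → Bool) →
  xorSum m (λ q → (f q xor g q) ∧ h q) ≡ xorSum m (λ q → f q ∧ h q) xor xorSum m (λ q → g q ∧ h q)
xorSum-∧-xor m f g h =
  trans (xorSum-cong m (λ q → ∧-distribʳ-xor (h q) (f q) (g q))) (xorSum-xor m _ _)

xorSum-∧-xor₅ : ∀ m (f₁ f₂ f₃ f₄ f₅ h : ℕ → Bool) →
  xorSum m (λ q → (f₁ q xor f₂ q xor f₃ q xor f₄ q xor f₅ q) ∧ h q) ≡
  xorSum m (λ q → f₁ q ∧ h q) xor xorSum m (λ q → f₂ q ∧ h q) xor xorSum m (λ q → f₃ q ∧ h q)
    xor xorSum m (λ q → f₄ q ∧ h q) xor xorSum m (λ q → f₅ q ∧ h q)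
xorSum-∧-xor₅ m f₁ f₂ f₃ f₄ f₅ h =
  trans (xorSum-∧-xor m f₁ (λ q → f₂ q xor f₃ q xor f₄ q xor f₅ q) h) (cong (part f₁ xor_)
  (trans (xorSum-∧-xor m f₂ (λ q → f₃ q xor f₄ q xor f₅ q) h) (cong (part f₂ xor_)
  (trans (xorSum-∧-xor m f₃ (λ q → f₄ q xor f₅ q) h) (cong (part f₃ xor_)
  (xorSum-∧-xor m f₄ f₅ h))))))
  where part : (ℕ → Bool) → Bool
        part f = xorSum m (λ q → f q ∧ h q)

xorSum-δ : ∀ {m} (v : Vec Bool m) u → xorSum m (λ q → (q ≡ᵇ u) ∧ at v q) ≡ at v u
xorSum-δ         []      u       = refl
xorSum-δ {suc m} (x ∷ v) zero    = trans (cong (x xor_) (xorSum-false m)) (xor-identityʳ x)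
xorSum-δ         (x ∷ v) (suc u) = xorSum-δ v u

xorSum-scaled-δ : ∀ {m} (v : Vec Bool m) c u {f : ℕ → Bool} →
                  (∀ q → f q ≡ c ∧ ((q ≡ᵇ u) ∧ at v q)) → xorSum m f ≡ c ∧ at v u
xorSum-scaled-δ {m} v c u f≗ =
  trans (xorSum-cong m f≗) (trans (xorSum-∧ˡ m c _) (cong (c ∧_) (xorSum-δ v u)))

xorSum-telescope : ∀ m (P : ℕ → Bool) → xorSum m (λ q → P q xor P (suc q)) ≡ P 0 xor P m
xorSum-telescope zero    P = sym (xor-same (P 0))
xorSum-telescope (suc m) P = trans (cong ((P 0 xor P 1) xor_) (xorSum-telescope m (P ∘ suc)))
                                   (xor-cancel-middle (P 0) (P 1) (P (suc m)))

xorSum-snoc : ∀ m (f : ℕ → Bool) → xorSum (suc m) f ≡ xorSum m f xor f m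
xorSum-snoc zero    f = xor-identityʳ (f 0)
xorSum-snoc (suc m) f = trans (cong (f 0 xor_) (xorSum-snoc m (f ∘ suc))) (sym (xor-assoc (f 0) _ _))

xorSum-at-tab : ∀ m (f : ℕ → Bool) → xorSum m (at (tab m f)) ≡ xorSum m f
xorSum-at-tab zero    f = refl
xorSum-at-tab (suc m) f = cong (f 0 xor_) (xorSum-at-tab m (f ∘ suc))

foldr-xor-tabulate : ∀ m (g : Fin m → Bool) (f : ℕ → Bool) → (∀ j → g j ≡ f (toℕ j)) →
                     foldr (λ _ → Bool) _xor_ false (tabulate g) ≡ xorSum m f
foldr-xor-tabulate zero    g f g≗f = refl
foldr-xor-tabulate (suc m) g f g≗f =
  cong₂ _xor_ (g≗f fzero) (foldr-xor-tabulate m (g ∘ fsuc) (f ∘ suc) (g≗f ∘ fsuc))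

odd : ℕ → Bool
odd zero          = false
odd (suc zero)    = true
odd (suc (suc w)) = odd w

odd-suc : ∀ w → odd (suc w) ≡ not (odd w)
odd-suc zero          = refl
odd-suc (suc zero)    = refl
odd-suc (suc (suc w)) = odd-suc w

odd-double : ∀ j → odd (j + j) ≡ false
odd-double zero    = refl
odd-double (suc j) rewrite +-suc j j = odd-double j

even⇒double : ∀ w → odd w ≡ false → ∃[ j ] w ≡ j + j
even⇒double zero          _    = 0 , refl
even⇒double (suc (suc w)) even with even⇒double w even
... | j , refl = suc j , cong suc (sym (+-suc j j))

double-≤-cancel : ∀ {i j} → i + i ≤ j + j → i ≤ j
double-≤-cancel i+i≤j+j = ≮⇒≥ (λ j<i → <⇒≱ (+-mono-< j<i j<i) i+i≤j+j)

double-injective : ∀ {i j} → i + i ≡ j + j → i ≡ j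
double-injective eq =
  ≤-antisym (double-≤-cancel (≤-reflexive eq)) (double-≤-cancel (≤-reflexive (sym eq)))

-- Words and adjacent transpositions

ones : ∀ {m} → Vec Bool m → ℕ
ones = countᵇ id

ones-≤ : ∀ {m} (v : Vec Bool m) → ones v ≤ m
ones-≤ = count≤n (T? ∘ id)

odd-ones : ∀ {m} (v : Vec Bool m) → odd (ones v) ≡ xorSum m (at v)
odd-ones []          = refl
odd-ones (true  ∷ v) = trans (odd-suc (ones v)) (cong not (odd-ones v))
odd-ones (false ∷ v) = odd-ones v

swapAt : ∀ {m} → ℕ → Vec Bool m → Vec Bool m
swapAt zero    (x ∷ y ∷ v) = y ∷ x ∷ v
swapAt (suc j) (x ∷ v)     = x ∷ swapAt j v
swapAt _       v           = v

swapAt-involutive : ∀ {m} j (v : Vec Bool m) → swapAt j (swapAt j v) ≡ v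
swapAt-involutive zero    []          = refl
swapAt-involutive zero    (x ∷ [])    = refl
swapAt-involutive zero    (x ∷ y ∷ v) = refl
swapAt-involutive (suc j) []          = refl
swapAt-involutive (suc j) (x ∷ v)     = cong (x ∷_) (swapAt-involutive j v)

ones-swapAt : ∀ {m} j (v : Vec Bool m) → ones (swapAt j v) ≡ ones v
ones-swapAt zero    []                  = refl
ones-swapAt zero    (x ∷ [])            = refl
ones-swapAt zero    (true  ∷ true  ∷ v) = refl
ones-swapAt zero    (true  ∷ false ∷ v) = refl
ones-swapAt zero    (false ∷ true  ∷ v) = refl
ones-swapAt zero    (false ∷ false ∷ v) = refl
ones-swapAt (suc j) []                  = refl
ones-swapAt (suc j) (true  ∷ v)         = cong suc (ones-swapAt j v)
ones-swapAt (suc j) (false ∷ v)         = ones-swapAt j v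

AdjacentSwap : ∀ {m} → Vec Bool m → Vec Bool m → Set
AdjacentSwap {m} v w = Σ ℕ λ j → 2 + j ≤ m × w ≡ swapAt j v

AdjacentSwap-sym : ∀ {m} {v w : Vec Bool m} → AdjacentSwap v w → AdjacentSwap w v
AdjacentSwap-sym {v = v} (j , j<m , refl) = j , j<m , sym (swapAt-involutive j v)

AdjacentSwaps-∷ : ∀ {m} x {v w : Vec Bool m} →
                  Star AdjacentSwap v w → Star AdjacentSwap (x ∷ v) (x ∷ w)
AdjacentSwaps-∷ x ε                        = ε
AdjacentSwaps-∷ x ((j , j<m , refl) ◅ v→w) = (suc j , s≤s j<m , refl) ◅ AdjacentSwaps-∷ x v→w

sorted : ∀ m → ℕ → Vec Bool m
sorted m c = tab m (_<ᵇ c)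

ones-sorted : ∀ m c → c ≤ m → ones (sorted m c) ≡ c
ones-sorted zero    zero    _         = refl
ones-sorted (suc m) zero    _         = ones-sorted m zero z≤n
ones-sorted (suc m) (suc c) (s≤s c≤m) = cong suc (ones-sorted m c c≤m)

bubble : ∀ m c → c ≤ m → Star AdjacentSwap (false ∷ sorted m c) (sorted (suc m) c)
bubble m       zero    _         = ε
bubble (suc m) (suc c) (s≤s c≤m) =
  (0 , s≤s (s≤s z≤n) , refl) ◅ AdjacentSwaps-∷ true (bubble m c c≤m)

sort : ∀ {m} (v : Vec Bool m) → Star AdjacentSwap v (sorted m (ones v))
sort []          = ε
sort (true  ∷ v) = AdjacentSwaps-∷ true (sort v)
sort (false ∷ v) = AdjacentSwaps-∷ false (sort v) ◅◅ bubble _ (ones v) (ones-≤ v)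

connect : ∀ {m} {v w : Vec Bool m} → ones v ≡ ones w → Star AdjacentSwap v w
connect {v = v} {w} v≈w =
  sort v ◅◅ subst (λ c → Star AdjacentSwap (sorted _ c) w) (sym v≈w) (reverse AdjacentSwap-sym (sort w))

ones-tab-flip : ∀ m (g : ℕ → Bool) {d} → d < m → g d ≡ false →
                ones (tab m (λ q → g q xor (q ≡ᵇ d))) ≡ suc (ones (tab m g))
ones-tab-flip (suc m) g {zero}  _         g0≡false
  rewrite g0≡false = cong (suc ∘ ones) (tab-cong m (λ {q} _ → xor-identityʳ (g (suc q))))
ones-tab-flip (suc m) g {suc d} (s≤s d<m) gd≡false with g 0
... | true  = cong suc (ones-tab-flip m (g ∘ suc) d<m gd≡false)
... | false = ones-tab-flip m (g ∘ suc) d<m gd≡false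

transpose : ℕ → ℕ → ℕ
transpose zero    zero       = 1
transpose zero    (suc zero) = 0
transpose zero    q          = q
transpose (suc j) zero       = zero
transpose (suc j) (suc q)    = suc (transpose j q)

swapAt-tab : ∀ j m (f : ℕ → Bool) → 2 + j ≤ m → swapAt j (tab m f) ≡ tab m (f ∘ transpose j)
swapAt-tab zero    (suc (suc m)) f _         = refl
swapAt-tab zero    (suc zero)    f (s≤s ())
swapAt-tab (suc j) (suc m)       f (s≤s j<m) = cong (f 0 ∷_) (swapAt-tab j m (f ∘ suc) j<m)

Δ : (ℕ → Bool) → ℕ → Bool
Δ P q = P q xor P (suc q)

Δ-transpose : ∀ j (P P′ : ℕ → Bool) →
              (∀ q → P′ q ≡ P q xor ((q ≡ᵇ suc j) ∧ (P j xor P (2 + j)))) →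
              ∀ q → Δ P′ q ≡ Δ P (transpose j q)
Δ-transpose zero P P′ P′≗ zero
  rewrite P′≗ 0 | P′≗ 1 | xor-identityʳ (P 0) =
  trans (x∙yz≈y∙xz (P 0) (P 1) (P 0 xor P 2)) (cong (P 1 xor_) (xor-cancelˡ (P 0) (P 2)))
Δ-transpose zero P P′ P′≗ (suc zero)
  rewrite P′≗ 1 | P′≗ 2 | xor-identityʳ (P 2) =
  trans (xor-assoc (P 1) (P 0 xor P 2) (P 2))
        (trans (cong (P 1 xor_) (xor-cancelʳ (P 0) (P 2))) (xor-comm (P 1) (P 0)))
Δ-transpose zero P P′ P′≗ (suc (suc q))
  rewrite P′≗ (2 + q) | P′≗ (3 + q) =
  cong₂ _xor_ (xor-identityʳ (P (2 + q))) (xor-identityʳ (P (3 + q)))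
Δ-transpose (suc j) P P′ P′≗ zero
  rewrite P′≗ 0 | P′≗ 1 = cong₂ _xor_ (xor-identityʳ (P 0)) (xor-identityʳ (P 1))
Δ-transpose (suc j) P P′ P′≗ (suc q) = Δ-transpose j (P ∘ suc) (P′ ∘ suc) (P′≗ ∘ suc) q

-- The tree D̃ₙ for n = 6 + t, on the vertices 0, …, n

module D̃ (t : ℕ) where

  n : ℕ
  n = 6 + t

  G : Graph (7 + t)
  G = Dtilde n

  edgeD-tests : ∀ a b → edgeD n a b ≡
    ((a ≡ᵇ 1) ∧ (b ≡ᵇ 2)) ∨ ((a ≡ᵇ 0) ∧ (b ≡ᵇ 2)) ∨ ((2 ≤ᵇ a) ∧ (a ≤ᵇ 3 + t) ∧ (b ≡ᵇ suc a))
    ∨ ((a ≡ᵇ 4 + t) ∧ (b ≡ᵇ 5 + t)) ∨ ((a ≡ᵇ 4 + t) ∧ (b ≡ᵇ 6 + t))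
  edgeD-tests a b
    rewrite isYes≗does (a ≟ 1) | isYes≗does (b ≟ 2) | isYes≗does (a ≟ 0) | isYes≗does (2 ≤? a)
          | isYes≗does (a ≤? 3 + t) | isYes≗does (b ≟ suc a) | isYes≗does (a ≟ 4 + t)
          | isYes≗does (b ≟ 5 + t) | isYes≗does (b ≟ 6 + t) = refl

  spine : ℕ → Bool
  spine a = (2 ≤ᵇ a) ∧ (a ≤ᵇ 3 + t)

  -- The five families of edges a → b (a < b) in edgeD are disjoint, so their xor is edgeD again;
  -- in this form sums over neighbours split into sums over the families.
  edge : ℕ → ℕ → Bool
  edge a b = ((a ≡ᵇ 1) ∧ (b ≡ᵇ 2)) xor ((a ≡ᵇ 0) ∧ (b ≡ᵇ 2)) xor (spine a ∧ (b ≡ᵇ suc a))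
             xor ((a ≡ᵇ 4 + t) ∧ (b ≡ᵇ 5 + t)) xor ((a ≡ᵇ 4 + t) ∧ (b ≡ᵇ 6 + t))

  data Vertex : ℕ → Set where
    leafˡ₀  : Vertex 0
    leafˡ₁  : Vertex 1
    branchˡ : Vertex 2
    inner   : ∀ r → r ≤ t → Vertex (3 + r)
    branchʳ : Vertex (4 + t)
    leafʳ₁  : Vertex (5 + t)
    leafʳ₀  : Vertex (6 + t)

  vertex : ∀ {p} → p < 7 + t → Vertex p
  vertex {0}                 _ = leafˡ₀
  vertex {1}                 _ = leafˡ₁
  vertex {2}                 _ = branchˡ
  vertex {suc (suc (suc r))} (s≤s (s≤s (s≤s r<4+t))) with r ≤? t
  ... | yes r≤t = inner r r≤t
  ... | no  r≰t with r ≟ 1 + t | r ≟ 2 + t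
  ...   | yes refl  | _         = branchʳ
  ...   | no  _     | yes refl  = leafʳ₁
  ...   | no  r≢1+t | no  r≢2+t with ≤-antisym (≤-pred r<4+t) 3+t≤r
    where 3+t≤r : 3 + t ≤ r
          3+t≤r = ≤∧≢⇒< (≤∧≢⇒< (≰⇒> r≰t) (r≢1+t ∘ sym)) (r≢2+t ∘ sym)
  ...     | refl = leafʳ₀

  edgeD≡edge : ∀ {a} → Vertex a → ∀ b → edgeD n a b ≡ edge a b
  edgeD≡edge leafˡ₀ b rewrite edgeD-tests 0 b = ∨-false≡xor-false (b ≡ᵇ 2)
  edgeD≡edge leafˡ₁ b rewrite edgeD-tests 1 b = ∨-false≡xor-false (b ≡ᵇ 2)
  edgeD≡edge branchˡ b rewrite edgeD-tests 2 b = ∨-false≡xor-false (b ≡ᵇ 3)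
  edgeD≡edge (inner r r≤t) b
    rewrite edgeD-tests (3 + r) b | ≤ᵇ-true {3 + r} {3 + t} (s≤s (s≤s (s≤s r≤t)))
          | ≡ᵇ-false {3 + r} {4 + t} (<⇒≢ (s≤s (s≤s (s≤s (s≤s r≤t)))))
          = ∨-false≡xor-false (b ≡ᵇ 4 + r)
  edgeD≡edge branchʳ b
    rewrite edgeD-tests (4 + t) b | ≤ᵇ-false {4 + t} {3 + t} (<⇒≱ ≤-refl) | ≡ᵇ-true {4 + t} refl
          = ∨≡xor-δ (<⇒≢ ≤-refl) b
  edgeD≡edge leafʳ₁ b
    rewrite edgeD-tests (5 + t) b | ≤ᵇ-false {5 + t} {3 + t} (<⇒≱ (n≤1+n _))
          | ≡ᵇ-false {5 + t} {4 + t} (>⇒≢ ≤-refl) = refl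
  edgeD≡edge leafʳ₀ b
    rewrite edgeD-tests (6 + t) b | ≤ᵇ-false {6 + t} {3 + t} (<⇒≱ (m≤n+m _ 2))
          | ≡ᵇ-false {6 + t} {4 + t} (>⇒≢ (n≤1+n _)) = refl

  edgeD-ascending : ∀ a b → T (edgeD n a b) → a < b
  edgeD-ascending a b = cases
    where
    edge₁₂ : T (⌊ a ≟ 1 ⌋ ∧ ⌊ b ≟ 2 ⌋) → a < b
    edge₁₂ e with toWitness-∧ {a? = a ≟ 1} {b ≟ 2} e
    ... | refl , refl = s≤s (s≤s z≤n)
    edge₀₂ : T (⌊ a ≟ 0 ⌋ ∧ ⌊ b ≟ 2 ⌋) → a < b
    edge₀₂ e with toWitness-∧ {a? = a ≟ 0} {b ≟ 2} e
    ... | refl , refl = s≤s z≤n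
    edge-spine : T (⌊ a ≤? 3 + t ⌋ ∧ ⌊ b ≟ suc a ⌋) → a < b
    edge-spine e with toWitness-∧ {a? = a ≤? 3 + t} {b ≟ suc a} e
    ... | _ , refl = ≤-refl
    edge-fork₅ : T (⌊ a ≟ 4 + t ⌋ ∧ ⌊ b ≟ 5 + t ⌋) → a < b
    edge-fork₅ e with toWitness-∧ {a? = a ≟ 4 + t} {b ≟ 5 + t} e
    ... | refl , refl = ≤-refl
    edge-fork₆ : T (⌊ a ≟ 4 + t ⌋ ∧ ⌊ b ≟ 6 + t ⌋) → a < b
    edge-fork₆ e with toWitness-∧ {a? = a ≟ 4 + t} {b ≟ 6 + t} e
    ... | refl , refl = n≤1+n _
    cases : T (edgeD n a b) → a < b
    cases e with T-∨-⊎ (⌊ a ≟ 1 ⌋ ∧ ⌊ b ≟ 2 ⌋) e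
    ... | inj₁ e₁ = edge₁₂ e₁
    ... | inj₂ e₂₋₅ with T-∨-⊎ (⌊ a ≟ 0 ⌋ ∧ ⌊ b ≟ 2 ⌋) e₂₋₅
    ...   | inj₁ e₂ = edge₀₂ e₂
    ...   | inj₂ e₃₋₅ with T-∨-⊎ (⌊ 2 ≤? a ⌋ ∧ ⌊ a ≤? 3 + t ⌋ ∧ ⌊ b ≟ suc a ⌋) e₃₋₅
    ...     | inj₁ e₃ = edge-spine (proj₂ (Equivalence.to (T-∧ {⌊ 2 ≤? a ⌋}) e₃))
    ...     | inj₂ e₄₋₅ with T-∨-⊎ (⌊ a ≟ 4 + t ⌋ ∧ ⌊ b ≟ 5 + t ⌋) e₄₋₅
    ...       | inj₁ e₄ = edge-fork₅ e₄
    ...       | inj₂ e₅ = edge-fork₆ e₅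

  adjacency≡edge : ∀ (i j : Fin (7 + t)) →
                   G i j ≡ edge (toℕ i) (toℕ j) xor edge (toℕ j) (toℕ i)
  adjacency≡edge i j =
    trans (∨≡xor {edgeD n (toℕ i) (toℕ j)}
             (λ i→j j→i → <-asym (edgeD-ascending _ _ i→j) (edgeD-ascending (toℕ j) (toℕ i) j→i)))
          (cong₂ _xor_ (edgeD≡edge (vertex (toℕ<n i)) (toℕ j)) (edgeD≡edge (vertex (toℕ<n j)) (toℕ i)))

  outSum : Labeling (7 + t) → ℕ → Bool
  outSum a p = ((p ≡ᵇ 1) ∧ at a 2) xor ((p ≡ᵇ 0) ∧ at a 2) xor (spine p ∧ at a (suc p))
               xor ((p ≡ᵇ 4 + t) ∧ at a (5 + t)) xor ((p ≡ᵇ 4 + t) ∧ at a (6 + t))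

  spineBelow : Labeling (7 + t) → ℕ → Bool
  spineBelow a zero    = false
  spineBelow a (suc p) = spine p ∧ at a p

  inSum : Labeling (7 + t) → ℕ → Bool
  inSum a p = ((p ≡ᵇ 2) ∧ at a 1) xor ((p ≡ᵇ 2) ∧ at a 0) xor spineBelow a p
              xor ((p ≡ᵇ 5 + t) ∧ at a (4 + t)) xor ((p ≡ᵇ 6 + t) ∧ at a (4 + t))

  xorSum-out : ∀ a p → xorSum (7 + t) (λ q → edge p q ∧ at a q) ≡ outSum a p
  xorSum-out a p =
    trans (xorSum-∧-xor₅ (7 + t) (λ q → (p ≡ᵇ 1) ∧ (q ≡ᵇ 2)) (λ q → (p ≡ᵇ 0) ∧ (q ≡ᵇ 2))
             (λ q → spine p ∧ (q ≡ᵇ suc p)) (λ q → (p ≡ᵇ 4 + t) ∧ (q ≡ᵇ 5 + t))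
             (λ q → (p ≡ᵇ 4 + t) ∧ (q ≡ᵇ 6 + t)) (at a))
      (cong₂ _xor_ (term (p ≡ᵇ 1) 2) (cong₂ _xor_ (term (p ≡ᵇ 0) 2) (cong₂ _xor_ (term (spine p) (suc p))
      (cong₂ _xor_ (term (p ≡ᵇ 4 + t) (5 + t)) (term (p ≡ᵇ 4 + t) (6 + t))))))
    where
    term : ∀ c u → xorSum (7 + t) (λ q → (c ∧ (q ≡ᵇ u)) ∧ at a q) ≡ c ∧ at a u
    term c u = xorSum-scaled-δ a c u (λ q → ∧-assoc c (q ≡ᵇ u) (at a q))

  xorSum-spineBelow : ∀ a p → xorSum (7 + t) (λ q → (spine q ∧ (p ≡ᵇ suc q)) ∧ at a q) ≡ spineBelow a p
  xorSum-spineBelow a zero    =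
    trans (xorSum-cong (7 + t) (λ q → cong (_∧ at a q) (∧-zeroʳ (spine q)))) (xorSum-false (7 + t))
  xorSum-spineBelow a (suc p) = xorSum-scaled-δ a (spine p) p pointwise
    where
    pointwise : ∀ q → (spine q ∧ (p ≡ᵇ q)) ∧ at a q ≡ spine p ∧ ((q ≡ᵇ p) ∧ at a q)
    pointwise q with q ≟ p
    ... | yes refl rewrite ≡ᵇ-true {q} refl = ∧-assoc (spine q) true (at a q)
    ... | no  q≢p  rewrite ≡ᵇ-false q≢p | ≡ᵇ-false (q≢p ∘ sym) | ∧-zeroʳ (spine q) =
      sym (∧-zeroʳ (spine p))

  xorSum-in : ∀ a p → xorSum (7 + t) (λ q → edge q p ∧ at a q) ≡ inSum a p
  xorSum-in a p =
    trans (xorSum-∧-xor₅ (7 + t) (λ q → (q ≡ᵇ 1) ∧ (p ≡ᵇ 2)) (λ q → (q ≡ᵇ 0) ∧ (p ≡ᵇ 2))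
             (λ q → spine q ∧ (p ≡ᵇ suc q)) (λ q → (q ≡ᵇ 4 + t) ∧ (p ≡ᵇ 5 + t))
             (λ q → (q ≡ᵇ 4 + t) ∧ (p ≡ᵇ 6 + t)) (at a))
      (cong₂ _xor_ (term (p ≡ᵇ 2) 1) (cong₂ _xor_ (term (p ≡ᵇ 2) 0) (cong₂ _xor_ (xorSum-spineBelow a p)
      (cong₂ _xor_ (term (p ≡ᵇ 5 + t) (4 + t)) (term (p ≡ᵇ 6 + t) (4 + t))))))
    where
    term : ∀ c u → xorSum (7 + t) (λ q → ((q ≡ᵇ u) ∧ c) ∧ at a q) ≡ c ∧ at a u
    term c u = xorSum-scaled-δ a c u (λ q → ∧-swapˡ (q ≡ᵇ u) c (at a q))

  neighbourSum-split : ∀ a i → neighbourSum G a i ≡ outSum a (toℕ i) xor inSum a (toℕ i)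
  neighbourSum-split a i = begin
    neighbourSum G a i
      ≡⟨ foldr-xor-tabulate (7 + t) _ (λ q → (edge p q xor edge q p) ∧ at a q)
           (λ j → cong₂ _∧_ (adjacency≡edge i j) (lookup≡at a j)) ⟩
    xorSum (7 + t) (λ q → (edge p q xor edge q p) ∧ at a q)
      ≡⟨ xorSum-∧-xor (7 + t) (edge p) (λ q → edge q p) (at a) ⟩
    xorSum (7 + t) (λ q → edge p q ∧ at a q) xor xorSum (7 + t) (λ q → edge q p ∧ at a q)
      ≡⟨ cong₂ _xor_ (xorSum-out a p) (xorSum-in a p) ⟩
    outSum a p xor inSum a p ∎
    where open ≡-Reasoning
          p = toℕ i

  interior : ℕ → Bool
  interior q = (1 ≤ᵇ q) ∧ (q ≤ᵇ 5 + t)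

  -- This is P; it vanishes at 0 and from n on.
  potential : Labeling (7 + t) → ℕ → Bool
  potential a q = ((q ≡ᵇ 1) ∧ at a 0) xor (interior q ∧ at a q) xor ((q ≡ᵇ 5 + t) ∧ at a (6 + t))

  -- The move at the vertex p transposes the letters slot p and slot p + 1 of the word.
  slot : ℕ → ℕ
  slot p = pred p ⊓ (4 + t)

  slot-suc : ∀ {q} → q ≤ 4 + t → slot (suc q) ≡ q
  slot-suc = m≤n⇒m⊓n≡m

  slot-n : slot (6 + t) ≡ 4 + t
  slot-n = m≥n⇒m⊓n≡n (n≤1+n _)

  outSum-inSum-potential : ∀ a {p} → Vertex p →
    outSum a p xor inSum a p ≡ potential a (slot p) xor potential a (2 + slot p)
  outSum-inSum-potential a leafˡ₀ = xor-identityʳ _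
  outSum-inSum-potential a leafˡ₁ = xor-identityʳ _
  outSum-inSum-potential a branchˡ =
    trans (xor-comm (at a 3 xor false) _)
          (cong (_xor (at a 3 xor false)) (x∙yz≈y∙xz (at a 1) (at a 0) false))
  outSum-inSum-potential a (inner r r≤t)
    rewrite m≤n⇒m⊓n≡m {r} {2 + t} (m≤n⇒m≤1+n (m≤n⇒m≤1+n r≤t))
          | ≤ᵇ-true {3 + r} {3 + t} (+-monoʳ-≤ 3 r≤t)
          | ≤ᵇ-true {2 + r} {3 + t} (+-mono-≤ (m≤n⇒m≤1+n ≤-refl) r≤t)
          | ≡ᵇ-false {3 + r} {4 + t} (<⇒≢ (+-mono-<-≤ ≤-refl r≤t))
          | ≡ᵇ-false {3 + r} {5 + t} (<⇒≢ (+-mono-<-≤ (n≤1+n _) r≤t))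
          | ≡ᵇ-false {3 + r} {6 + t} (<⇒≢ (+-mono-<-≤ (m≤n+m _ 2) r≤t))
          | ≤ᵇ-true {2 + r} {5 + t} (+-mono-≤ (m≤n+m _ 3) r≤t)
          = xor-comm (at a (4 + r) xor false) (at a (2 + r) xor false)
  outSum-inSum-potential a branchʳ
    rewrite m≤n⇒m⊓n≡m {t} {1 + t} (n≤1+n t)
          | ≤ᵇ-false {4 + t} {3 + t} (<⇒≱ ≤-refl) | ≤ᵇ-true {3 + t} {3 + t} ≤-refl
          | ≤ᵇ-true {3 + t} {5 + t} (m≤n+m _ 2) | ≡ᵇ-true {t} refl
          | ≡ᵇ-false {4 + t} {5 + t} (<⇒≢ ≤-refl) | ≡ᵇ-false {4 + t} {6 + t} (<⇒≢ (n≤1+n _))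
          = xor-comm (at a (5 + t) xor at a (6 + t)) _
  outSum-inSum-potential a leafʳ₁
    rewrite ⊓-idem t
          | ≤ᵇ-false {5 + t} {3 + t} (<⇒≱ (n≤1+n _)) | ≤ᵇ-false {4 + t} {3 + t} (<⇒≱ ≤-refl)
          | ≤ᵇ-true {4 + t} {5 + t} (n≤1+n _) | ≡ᵇ-true {t} refl
          | ≡ᵇ-false {5 + t} {4 + t} (>⇒≢ ≤-refl) | ≡ᵇ-false {5 + t} {6 + t} (<⇒≢ ≤-refl)
          = sym (xor-identityʳ (at a (4 + t) xor false))
  outSum-inSum-potential a leafʳ₀
    rewrite m≥n⇒m⊓n≡n {suc t} {t} (n≤1+n t)
          | ≤ᵇ-false {6 + t} {3 + t} (<⇒≱ (m≤n+m _ 2)) | ≤ᵇ-false {5 + t} {3 + t} (<⇒≱ (n≤1+n _))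
          | ≤ᵇ-true {4 + t} {5 + t} (n≤1+n _) | ≡ᵇ-true {t} refl
          | ≡ᵇ-false {6 + t} {4 + t} (>⇒≢ (n≤1+n _)) | ≡ᵇ-false {6 + t} {5 + t} (>⇒≢ ≤-refl)
          | ≤ᵇ-false {4 + t} {3 + t} (<⇒≱ ≤-refl) | ≡ᵇ-false {5 + t} {6 + t} (<⇒≢ ≤-refl)
          = sym (trans (xor-identityʳ _) (xor-identityʳ (at a (4 + t))))

  neighbourSum≡potential : ∀ a i →
    neighbourSum G a i ≡ potential a (slot (toℕ i)) xor potential a (2 + slot (toℕ i))
  neighbourSum≡potential a i =
    trans (neighbourSum-split a i) (outSum-inSum-potential a (vertex (toℕ<n i)))

  potential-coefficient : ∀ {p} → p ≤ 6 + t → ∀ q d →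
    ((q ≡ᵇ 1) ∧ ((0 ≡ᵇ p) ∧ d)) xor (interior q ∧ ((q ≡ᵇ p) ∧ d)) xor ((q ≡ᵇ 5 + t) ∧ ((6 + t ≡ᵇ p) ∧ d))
      ≡ (q ≡ᵇ suc (slot p)) ∧ d
  potential-coefficient {zero} _ zero    d = refl
  potential-coefficient {zero} _ (suc q) d
    rewrite ∧-zeroʳ (interior (suc q)) | ∧-zeroʳ (suc q ≡ᵇ 5 + t) = xor-identityʳ _
  potential-coefficient {suc p} (s≤s p≤5+t) q d with p ≤? 4 + t
  ... | yes p≤4+t
    rewrite m≤n⇒m⊓n≡m p≤4+t | ∧-zeroʳ (q ≡ᵇ 1)
          | ≡ᵇ-false {5 + t} {p} (>⇒≢ (s≤s p≤4+t)) | ∧-zeroʳ (q ≡ᵇ 5 + t) with q ≟ suc p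
  ...   | yes refl rewrite ≡ᵇ-true {q} refl | ≤ᵇ-true {q} {5 + t} (s≤s p≤4+t) = xor-identityʳ d
  ...   | no  q≢p  rewrite ≡ᵇ-false q≢p | ∧-zeroʳ (interior q) = refl
  potential-coefficient {suc p} (s≤s p≤5+t) q d | no p≰4+t
    with refl ← ≤-antisym p≤5+t (≰⇒> p≰4+t)
    rewrite m≥n⇒m⊓n≡n {5 + t} {4 + t} (n≤1+n _) | ∧-zeroʳ (q ≡ᵇ 1) | ≡ᵇ-true {t} refl with q ≟ 6 + t
  ...   | yes refl rewrite ≤ᵇ-false {6 + t} {5 + t} (<⇒≱ ≤-refl) = refl
  ...   | no  q≢6+t rewrite ≡ᵇ-false q≢6+t | ∧-zeroʳ (interior q) = refl

  potential-update : ∀ (a a′ : Labeling (7 + t)) {p} d → p ≤ 6 + t →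
    (∀ q → at a′ q ≡ at a q xor ((q ≡ᵇ p) ∧ d)) →
    ∀ q → potential a′ q ≡ potential a q xor ((q ≡ᵇ suc (slot p)) ∧ d)
  potential-update a a′ {p} d p≤6+t a′≗ q
    rewrite a′≗ 0 | a′≗ q | a′≗ (6 + t) =
    trans (linear (q ≡ᵇ 1) (interior q) (q ≡ᵇ 5 + t) (at a 0) (at a q) (at a (6 + t)) _ _ _)
          (cong (potential a q xor_) (potential-coefficient p≤6+t q d))
    where
    linear : ∀ x y z u v w u′ v′ w′ →
      (x ∧ (u xor u′)) xor (y ∧ (v xor v′)) xor (z ∧ (w xor w′)) ≡
      ((x ∧ u) xor (y ∧ v) xor (z ∧ w)) xor ((x ∧ u′) xor (y ∧ v′) xor (z ∧ w′))
    linear x y z u v w u′ v′ w′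
      rewrite ∧-distribˡ-xor x u u′ | ∧-distribˡ-xor y v v′ | ∧-distribˡ-xor z w w′
            | interchange (y ∧ v) (y ∧ v′) (z ∧ w) (z ∧ w′) = interchange (x ∧ u) (x ∧ u′) _ _

  word : Labeling (7 + t) → Vec Bool n
  word a = tab n (Δ (potential a))

  slot-bound : ∀ p → 2 + slot p ≤ n
  slot-bound p = +-monoʳ-≤ 2 (m⊓n≤n (pred p) (4 + t))

  at-word : ∀ a {q} → q < n → at (word a) q ≡ Δ (potential a) q
  at-word a = at-tab (Δ (potential a))

  neighbourSum≡word : ∀ a i →
    neighbourSum G a i ≡ at (word a) (slot (toℕ i)) xor at (word a) (suc (slot (toℕ i)))
  neighbourSum≡word a i = begin
    neighbourSum G a i
      ≡⟨ neighbourSum≡potential a i ⟩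
    P j xor P (2 + j)
      ≡⟨ xor-cancel-middle (P j) (P (suc j)) (P (2 + j)) ⟨
    Δ P j xor Δ P (suc j)
      ≡⟨ cong₂ _xor_ (at-word a (<-trans (n<1+n _) j<n)) (at-word a j<n) ⟨
    at (word a) j xor at (word a) (suc j) ∎
    where open ≡-Reasoning
          P = potential a
          j = slot (toℕ i)
          j<n = slot-bound (toℕ i)

  at-move : ∀ a i q → at (move G i a) q ≡ at a q xor ((q ≡ᵇ toℕ i) ∧ neighbourSum G a i)
  at-move a i = at-updateAt-xor a i (neighbourSum G a i)

  word-move : ∀ a i → word (move G i a) ≡ swapAt (slot (toℕ i)) (word a)
  word-move a i = begin
    tab n (Δ (potential (move G i a)))
      ≡⟨ tab-cong n (λ {q} _ → Δ-transpose j (potential a) _ potential-move q) ⟩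
    tab n (Δ (potential a) ∘ transpose j)
      ≡⟨ swapAt-tab j n (Δ (potential a)) (slot-bound (toℕ i)) ⟨
    swapAt j (word a) ∎
    where
    open ≡-Reasoning
    j = slot (toℕ i)
    potential-move : ∀ q → potential (move G i a) q ≡
                     potential a q xor ((q ≡ᵇ suc j) ∧ (potential a j xor potential a (2 + j)))
    potential-move q = trans (potential-update a (move G i a) _ (≤-pred (toℕ<n i)) (at-move a i) q)
                             (cong (λ d → potential a q xor ((q ≡ᵇ suc j) ∧ d)) (neighbourSum≡potential a i))

  potential-word : ∀ {a b} → word a ≡ word b → ∀ {q} → q ≤ n → potential a q ≡ potential b q
  potential-word eq {zero}  _   = refl
  potential-word {a} {b} eq {suc q} q<n = begin
    potential a (suc q)                    ≡⟨ sym (xor-cancelˡ (potential a q) _) ⟩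
    potential a q xor Δ (potential a) q    ≡⟨ cong₂ _xor_ (potential-word {a} {b} eq (<⇒≤ q<n)) same-Δ ⟩
    potential b q xor Δ (potential b) q    ≡⟨ xor-cancelˡ (potential b q) _ ⟩
    potential b (suc q)                    ∎
    where
    open ≡-Reasoning
    same-Δ : Δ (potential a) q ≡ Δ (potential b) q
    same-Δ = trans (sym (at-word a q<n)) (trans (cong (λ v → at v q) eq) (at-word b q<n))

  word-injective : ∀ {a b} → word a ≡ word b → at a 0 ≡ at b 0 → at a n ≡ at b n → a ≡ b
  word-injective {a} {b} eq e₀ eₙ = at-injective labels
    where
    unfold : ∀ c {q} → interior q ≡ true →
             potential c q ≡ ((q ≡ᵇ 1) ∧ at c 0) xor (at c q xor ((q ≡ᵇ 5 + t) ∧ at c n))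
    unfold c interior≡true rewrite interior≡true = refl
    labels : ∀ q → at a q ≡ at b q
    labels zero = e₀
    labels (suc q) with q ≤? 4 + t
    ... | yes q≤4+t =
      ∙-cancelʳ ((suc q ≡ᵇ 5 + t) ∧ at a n) _ _ (∙-cancelˡ ((suc q ≡ᵇ 1) ∧ at a 0) _ _ (begin
      ((suc q ≡ᵇ 1) ∧ at a 0) xor (at a (suc q) xor ((suc q ≡ᵇ 5 + t) ∧ at a n))
        ≡⟨ sym (unfold a {suc q} interior≡true) ⟩
      potential a (suc q)
        ≡⟨ potential-word {a} {b} eq (s≤s (m≤n⇒m≤1+n q≤4+t)) ⟩
      potential b (suc q)
        ≡⟨ unfold b {suc q} interior≡true ⟩
      ((suc q ≡ᵇ 1) ∧ at b 0) xor (at b (suc q) xor ((suc q ≡ᵇ 5 + t) ∧ at b n))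
        ≡⟨ cong₂ (λ x y → ((suc q ≡ᵇ 1) ∧ x) xor (at b (suc q) xor ((suc q ≡ᵇ 5 + t) ∧ y)))
                 (sym e₀) (sym eₙ) ⟩
      ((suc q ≡ᵇ 1) ∧ at a 0) xor (at b (suc q) xor ((suc q ≡ᵇ 5 + t) ∧ at a n)) ∎))
      where open ≡-Reasoning
            interior≡true : interior (suc q) ≡ true
            interior≡true = ≤ᵇ-true {suc q} {5 + t} (s≤s q≤4+t)
    ... | no q≰4+t with q ≟ 5 + t
    ...   | yes refl = eₙ
    ...   | no  q≢5+t = trans (at-≥ a beyond) (sym (at-≥ b beyond))
      where beyond : 7 + t ≤ suc q
            beyond = s≤s (≤∧≢⇒< (≰⇒> q≰4+t) (q≢5+t ∘ sym))

  potential-n : ∀ a → potential a n ≡ false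
  potential-n a
    rewrite ≤ᵇ-false {6 + t} {5 + t} (<⇒≱ ≤-refl) | ≡ᵇ-false {6 + t} {5 + t} (>⇒≢ ≤-refl) = refl

  ones-word-even : ∀ a → odd (ones (word a)) ≡ false
  ones-word-even a = begin
    odd (ones (word a))                   ≡⟨ odd-ones (word a) ⟩
    xorSum n (at (word a))                ≡⟨ xorSum-at-tab n (Δ (potential a)) ⟩
    xorSum n (Δ (potential a))            ≡⟨ xorSum-telescope n (potential a) ⟩
    false xor potential a n               ≡⟨ potential-n a ⟩
    false                                 ∎
    where open ≡-Reasoning

  potential-at : ∀ a (ℓ : ℕ → Bool) → (∀ {q} → q < 7 + t → at a q ≡ ℓ q) → ∀ {q} → q ≤ n →
    potential a q ≡ ((q ≡ᵇ 1) ∧ ℓ 0) xor (interior q ∧ ℓ q) xor ((q ≡ᵇ 5 + t) ∧ ℓ (6 + t))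
  potential-at a ℓ a≗ℓ q≤n rewrite a≗ℓ (s≤s z≤n) | a≗ℓ (s≤s q≤n) | a≗ℓ {6 + t} ≤-refl = refl

  -- Inverse to a ↦ (word a, a₀, aₙ) on words with an even number of ones: the prefix sums of the
  -- word give back the potential.
  decode : Vec Bool n → Bool → Bool → Labeling (7 + t)
  decode x b₀ bₙ = tab (7 + t) (λ q → xorSum q (at x) xor ((q ≤ᵇ 1) ∧ b₀) xor ((5 + t ≤ᵇ q) ∧ bₙ))

  module _ (x : Vec Bool n) (x-even : odd (ones x) ≡ false) (b₀ bₙ : Bool) where

    private
      label : ℕ → Bool
      label q = xorSum q (at x) xor ((q ≤ᵇ 1) ∧ b₀) xor ((5 + t ≤ᵇ q) ∧ bₙ)
      x-total : xorSum n (at x) ≡ false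
      x-total = trans (sym (odd-ones x)) x-even

    at-decode-0 : at (decode x b₀ bₙ) 0 ≡ b₀
    at-decode-0 = xor-identityʳ b₀

    at-decode-n : at (decode x b₀ bₙ) n ≡ bₙ
    at-decode-n rewrite at-tab label {n} ≤-refl | x-total | ≤ᵇ-true {5 + t} {6 + t} (n≤1+n _) = refl

    potential-decode : ∀ {q} → q ≤ n → potential (decode x b₀ bₙ) q ≡ xorSum q (at x)
    potential-decode {q} q≤n =
      trans (potential-at (decode x b₀ bₙ) label (at-tab label) q≤n) (evaluate q≤n)
      where
      evaluate : ∀ {q} → q ≤ n →
        ((q ≡ᵇ 1) ∧ label 0) xor (interior q ∧ label q) xor ((q ≡ᵇ 5 + t) ∧ label (6 + t))
          ≡ xorSum q (at x)
      evaluate {zero} _ = refl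
      evaluate {suc zero} _ = cancel (at x 0) b₀
        where cancel : ∀ x₀ b →
                       (b xor false) xor (((x₀ xor false) xor b xor false) xor false) ≡ x₀ xor false
              cancel false false = refl
              cancel false true  = refl
              cancel true  false = refl
              cancel true  true  = refl
      evaluate {suc (suc r)} (s≤s (s≤s r≤4+t)) with r ≤? 2 + t
      ... | yes r≤2+t
        rewrite ≤ᵇ-true {2 + r} {5 + t} (<⇒≤ (s≤s (s≤s (s≤s r≤2+t))))
              | ≡ᵇ-false {2 + r} {5 + t} (<⇒≢ (s≤s (s≤s (s≤s r≤2+t))))
              | ≤ᵇ-false {5 + t} {2 + r} (<⇒≱ (s≤s (s≤s (s≤s r≤2+t))))
              = trans (xor-identityʳ _) (xor-identityʳ _)
      ... | no  r≰2+t with r ≟ 3 + t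
      ...   | yes refl
        rewrite ≤ᵇ-true {5 + t} {5 + t} ≤-refl | ≡ᵇ-true {t} refl | ≤ᵇ-true {5 + t} {6 + t} (n≤1+n _)
              | x-total = xor-cancelʳ (xorSum (5 + t) (at x)) bₙ
      ...   | no  r≢3+t with ≤-antisym r≤4+t (≤∧≢⇒< (≰⇒> r≰2+t) (r≢3+t ∘ sym))
      ...     | refl
        rewrite ≤ᵇ-false {6 + t} {5 + t} (<⇒≱ ≤-refl) | ≡ᵇ-false {6 + t} {5 + t} (>⇒≢ ≤-refl)
              = sym x-total

    word-decode : word (decode x b₀ bₙ) ≡ x
    word-decode = trans (tab-cong n Δ≡at) (tab-at x)
      where
      Δ≡at : ∀ {q} → q < n → Δ (potential (decode x b₀ bₙ)) q ≡ at x q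
      Δ≡at {q} q<n = begin
        potential (decode x b₀ bₙ) q xor potential (decode x b₀ bₙ) (suc q)
          ≡⟨ cong₂ _xor_ (potential-decode (<⇒≤ q<n)) (potential-decode q<n) ⟩
        xorSum q (at x) xor xorSum (suc q) (at x)
          ≡⟨ cong (xorSum q (at x) xor_) (xorSum-snoc q (at x)) ⟩
        xorSum q (at x) xor (xorSum q (at x) xor at x q)
          ≡⟨ xor-cancelˡ (xorSum q (at x)) (at x q) ⟩
        at x q ∎
        where open ≡-Reasoning

  decode-word : ∀ a → decode (word a) (at a 0) (at a n) ≡ a
  decode-word a = word-injective (word-decode (word a) (ones-word-even a) (at a 0) (at a n))
                                 (at-decode-0 (word a) (ones-word-even a) (at a 0) (at a n))
                                 (at-decode-n (word a) (ones-word-even a) (at a 0) (at a n))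

  Equiv-decode : ∀ {a a′ v b₀ bₙ} → Equiv G a a′ → word a′ ≡ v → at a′ 0 ≡ b₀ → at a′ n ≡ bₙ →
                 Equiv G a (decode v b₀ bₙ)
  Equiv-decode {a′ = a′} a→a′ refl refl refl = subst (Equiv G _) (sym (decode-word a′)) a→a′

  ones-invariant : ∀ {a b} → Equiv G a b → ones (word a) ≡ ones (word b)
  ones-invariant ε = refl
  ones-invariant {a} ((i , refl) ◅ a→b) =
    trans (sym (trans (cong ones (word-move a i)) (ones-swapAt (slot (toℕ i)) (word a))))
          (ones-invariant a→b)

  move-trivial : ∀ a i → at (word a) (slot (toℕ i)) ≡ at (word a) (suc (slot (toℕ i))) →
                 move G i a ≡ a
  move-trivial a i same = at-injective λ q → begin
    at (move G i a) q                                 ≡⟨ at-move a i q ⟩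
    at a q xor ((q ≡ᵇ toℕ i) ∧ neighbourSum G a i)    ≡⟨ cong (λ d → at a q xor ((q ≡ᵇ toℕ i) ∧ d)) no-change ⟩
    at a q xor ((q ≡ᵇ toℕ i) ∧ false)                 ≡⟨ cong (at a q xor_) (∧-zeroʳ _) ⟩
    at a q xor false                                  ≡⟨ xor-identityʳ _ ⟩
    at a q                                            ∎
    where open ≡-Reasoning
          no-change : neighbourSum G a i ≡ false
          no-change = trans (neighbourSum≡word a i)
                            (trans (cong (_xor at (word a) (suc (slot (toℕ i)))) same)
                                   (xor-same (at (word a) (suc (slot (toℕ i))))))

  Equiv-fixed : ∀ {a b} → (∀ i → move G i a ≡ a) → Equiv G a b → a ≡ b
  Equiv-fixed fixed ε = refl
  Equiv-fixed fixed ((i , refl) ◅ a→b) rewrite fixed i = Equiv-fixed fixed a→b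

  at-move-other : ∀ a i {q} → q ≢ toℕ i → at (move G i a) q ≡ at a q
  at-move-other a i {q} q≢i
    rewrite at-move a i q | ≡ᵇ-false q≢i = xor-identityʳ (at a q)

  realize-swaps : ∀ {u v} → Star AdjacentSwap u v → ∀ a → word a ≡ u →
                  Equiv G a (decode v (at a 0) (at a n))
  realize-swaps ε a a↦u = Equiv-decode ε a↦u refl refl
  realize-swaps {v = v} ((j , 2+j≤n , refl) ◅ rest) a refl =
    (i , refl) ◅ subst₂ (λ b₀ bₙ → Equiv G a′ (decode v b₀ bₙ)) end₀ endₙ (realize-swaps rest a′ word-a′)
    where
    i : Fin (7 + t)
    i = fromℕ< (m≤n⇒m≤1+n 2+j≤n)
    toℕ-i : toℕ i ≡ suc j
    toℕ-i = toℕ-fromℕ< (m≤n⇒m≤1+n 2+j≤n)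
    a′ = move G i a
    word-a′ : word a′ ≡ swapAt j (word a)
    word-a′ = trans (word-move a i) (cong (λ k → swapAt k (word a))
                                          (trans (cong slot toℕ-i) (slot-suc (≤-pred (≤-pred 2+j≤n)))))
    end₀ : at a′ 0 ≡ at a 0
    end₀ = at-move-other a i (λ 0≡i → 0≢1+n (trans 0≡i toℕ-i))
    endₙ : at a′ n ≡ at a n
    endₙ = at-move-other a i (λ n≡i → <⇒≢ 2+j≤n (sym (trans n≡i toℕ-i)))

  rearrange : ∀ v v′ b₀ bₙ → odd (ones v) ≡ false → ones v ≡ ones v′ →
              Equiv G (decode v b₀ bₙ) (decode v′ b₀ bₙ)
  rearrange v v′ b₀ bₙ v-even v≈v′ =
    subst₂ (λ c₀ cₙ → Equiv G (decode v b₀ bₙ) (decode v′ c₀ cₙ))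
           (at-decode-0 v v-even b₀ bₙ) (at-decode-n v v-even b₀ bₙ)
           (realize-swaps {v = v′} (connect v≈v′) (decode v b₀ bₙ) (word-decode v v-even b₀ bₙ))

  flip-end₀ : ∀ v bₙ → odd (ones v) ≡ false → at v 0 xor at v 1 ≡ true →
               Equiv G (decode v true bₙ) (decode (swapAt 0 v) false bₙ)
  flip-end₀ v bₙ v-even boundary = Equiv-decode ((fzero , refl) ◅ ε) word-a′ end₀ endₙ
    where
    a = decode v true bₙ
    flips : neighbourSum G a fzero ≡ true
    flips = trans (neighbourSum≡word a fzero)
                  (trans (cong (λ w → at w 0 xor at w 1) (word-decode v v-even true bₙ)) boundary)
    word-a′ : word (move G fzero a) ≡ swapAt 0 v
    word-a′ = trans (word-move a fzero) (cong (swapAt 0) (word-decode v v-even true bₙ))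
    end₀ : at (move G fzero a) 0 ≡ false
    end₀ = trans (at-move a fzero 0) (cong₂ (λ x d → x xor d) (at-decode-0 v v-even true bₙ) flips)
    endₙ : at (move G fzero a) n ≡ bₙ
    endₙ = trans (at-move-other a fzero {n} (λ ())) (at-decode-n v v-even true bₙ)

  flip-endₙ : ∀ v b₀ → odd (ones v) ≡ false → at v (4 + t) xor at v (5 + t) ≡ true →
               Equiv G (decode v b₀ true) (decode (swapAt (4 + t) v) b₀ false)
  flip-endₙ v b₀ v-even boundary = Equiv-decode ((last , refl) ◅ ε) word-a′ end₀ endₙ
    where
    a = decode v b₀ true
    last : Fin (7 + t)
    last = fromℕ n
    slot-last : slot (toℕ last) ≡ 4 + t
    slot-last = trans (cong slot (toℕ-fromℕ n)) slot-n
    flips : neighbourSum G a last ≡ true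
    flips = trans (neighbourSum≡word a last)
                  (trans (cong (λ k → at (word a) k xor at (word a) (suc k)) slot-last)
                         (trans (cong (λ w → at w (4 + t) xor at w (5 + t)) (word-decode v v-even b₀ true))
                                boundary))
    word-a′ : word (move G last a) ≡ swapAt (4 + t) v
    word-a′ = trans (word-move a last) (cong₂ swapAt slot-last (word-decode v v-even b₀ true))
    end₀ : at (move G last a) 0 ≡ b₀
    end₀ = trans (at-move-other a last {0} (λ 0≡n → 0≢1+n (trans 0≡n (toℕ-fromℕ n))))
                 (at-decode-0 v v-even b₀ true)
    endₙ : at (move G last a) n ≡ false
    endₙ = trans (at-move a last n)
                 (trans (cong₂ (λ x c → x xor (c ∧ neighbourSum G a last))
                               (at-decode-n v v-even b₀ true) (≡ᵇ-true (sym (toℕ-fromℕ n))))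
                        (cong (true xor_) flips))

  reset-end₀ : ∀ v b₀ bₙ → odd (ones v) ≡ false → 1 ≤ ones v → ones v ≤ 5 + t →
              Equiv G (decode v b₀ bₙ) (decode v false bₙ)
  reset-end₀ v false bₙ _      _   _     = ε
  reset-end₀ v true  bₙ v-even 1≤w w≤5+t =
    rearrange v u true bₙ v-even (sym ones-u) ◅◅ flip-end₀ u bₙ u-even boundary
      ◅◅ rearrange (swapAt 0 u) v false bₙ (trans (cong odd (ones-swapAt 0 u)) u-even)
                   (trans (ones-swapAt 0 u) ones-u)
    where
    u : Vec Bool n
    u = false ∷ sorted (5 + t) (ones v)
    ones-u : ones u ≡ ones v
    ones-u = ones-sorted (5 + t) (ones v) w≤5+t
    u-even : odd (ones u) ≡ false
    u-even = trans (cong odd ones-u) v-even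
    boundary : at u 0 xor at u 1 ≡ true
    boundary = trans (at-tab {5 + t} (_<ᵇ ones v) {0} (s≤s z≤n)) (≤ᵇ-true 1≤w)

  reset-endₙ : ∀ v b₀ bₙ → odd (ones v) ≡ false → 1 ≤ ones v → ones v ≤ 5 + t →
              Equiv G (decode v b₀ bₙ) (decode v b₀ false)
  reset-endₙ v b₀ false _      _   _     = ε
  reset-endₙ v b₀ true  v-even 1≤w w≤5+t =
    rearrange v u b₀ true v-even (sym ones-u) ◅◅ flip-endₙ u b₀ u-even boundary
      ◅◅ rearrange (swapAt (4 + t) u) v b₀ false (trans (cong odd (ones-swapAt (4 + t) u)) u-even)
                   (trans (ones-swapAt (4 + t) u) ones-u)
    where
    c = pred (ones v)
    u : Vec Bool n
    u = tab n (λ q → (q <ᵇ c) xor (q ≡ᵇ 4 + t))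
    c<5+t : c < 5 + t
    c<5+t = s≤s (pred-mono-≤ w≤5+t)
    ones-u : ones u ≡ ones v
    ones-u = trans (ones-tab-flip n (_<ᵇ c) (n≤1+n _) (≤ᵇ-false (<⇒≱ c<5+t)))
                   (trans (cong suc (ones-sorted n c (≤-trans (<⇒≤ c<5+t) (n≤1+n _))))
                          (suc-pred (ones v) ⦃ >-nonZero 1≤w ⦄))
    u-even : odd (ones u) ≡ false
    u-even = trans (cong odd ones-u) v-even
    boundary : at u (4 + t) xor at u (5 + t) ≡ true
    boundary
      rewrite at-tab (λ q → (q <ᵇ c) xor (q ≡ᵇ 4 + t)) {4 + t} (n≤1+n _)
            | at-tab (λ q → (q <ᵇ c) xor (q ≡ᵇ 4 + t)) {5 + t} ≤-refl
            | ≤ᵇ-false (<⇒≱ c<5+t) | ≤ᵇ-false (<⇒≱ (≤-trans c<5+t (n≤1+n _)))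
            | ≡ᵇ-true {4 + t} refl | ≡ᵇ-false {5 + t} {4 + t} (>⇒≢ ≤-refl) = refl

-- HasExactlyClasses G N unfolds to Representatives G (Fin N).
Representatives : ∀ {m} → Graph m → Set → Set
Representatives {m} G I =
  Σ (I → Labeling m) λ r →
    ((i j : I) → Equiv G (r i) (r j) → i ≡ j) × ((a : Labeling m) → Σ I λ i → Equiv G a (r i))

Representatives-↔ : ∀ {m} {G : Graph m} {I J : Set} →
                    I ↔ J → Representatives G J → Representatives G I
Representatives-↔ {G = G} I↔J (r , separated , complete) = r ∘ to , separated′ , complete′
  where
  open Inverse I↔J
  separated′ : ∀ i j → Equiv G (r (to i)) (r (to j)) → i ≡ j
  separated′ i j e =
    trans (sym (strictlyInverseʳ i)) (trans (cong from (separated (to i) (to j) e)) (strictlyInverseʳ j))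
  complete′ : ∀ a → Σ _ λ i → Equiv G a (r (to i))
  complete′ a = from (proj₁ (complete a)) , subst (Equiv G a ∘ r) (sym (strictlyInverseˡ _)) (proj₂ (complete a))

-- The classes of D̃ₙ for n = 2k, k = 3 + s

module Classification (s : ℕ) where
  open D̃ (s + s)

  -- (c , a₀ , aₙ) stands for the labeling with constant word c and end labels a₀, aₙ, and i for
  -- the class of the labelings whose word has 2 + 2i ones.
  Class : Set
  Class = (Bool × Bool × Bool) ⊎ Fin (2 + s)

  Fin↔Class : Fin (10 + s) ↔ Class
  Fin↔Class = ↔-trans (+↔⊎ {8} {2 + s}) (eight ⊎-↔ ↔-refl)
    where eight : Fin 8 ↔ (Bool × Bool × Bool)
          eight = ↔-trans (*↔× {2} {4}) (2↔Bool ×-↔ ↔-trans (*↔× {2} {2}) (2↔Bool ×-↔ 2↔Bool))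

  extreme : Bool → ℕ
  extreme false = 0
  extreme true  = n

  weight : Class → ℕ
  weight (inj₁ (c , _)) = extreme c
  weight (inj₂ i)       = 2 + (toℕ i + toℕ i)

  ends : Class → Bool × Bool
  ends (inj₁ (_ , e)) = e
  ends (inj₂ _)       = false , false

  representative : Class → Labeling (7 + (s + s))
  representative c = decode (sorted n (weight c)) (proj₁ (ends c)) (proj₂ (ends c))

  weight-even : ∀ c → odd (weight c) ≡ false
  weight-even (inj₁ (false , _)) = refl
  weight-even (inj₁ (true  , _)) = odd-double s
  weight-even (inj₂ i)           = odd-double (toℕ i)

  middle-weight : ∀ (i : Fin (2 + s)) → 1 ≤ weight (inj₂ i) × weight (inj₂ i) ≤ 5 + (s + s)
  middle-weight i =
    s≤s z≤n , s≤s (s≤s (m≤n⇒m≤1+n (≤-trans (+-mono-≤ i≤1+s i≤1+s) (≤-reflexive double))))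
    where i≤1+s : toℕ i ≤ 1 + s
          i≤1+s = ≤-pred (toℕ<n i)
          double : (1 + s) + (1 + s) ≡ 2 + (s + s)
          double = cong suc (+-suc s s)

  weight-≤ : ∀ c → weight c ≤ n
  weight-≤ (inj₁ (false , _)) = z≤n
  weight-≤ (inj₁ (true  , _)) = ≤-refl
  weight-≤ (inj₂ i)           = m≤n⇒m≤1+n (proj₂ (middle-weight i))

  ones-sorted-weight : ∀ c → ones (sorted n (weight c)) ≡ weight c
  ones-sorted-weight c = ones-sorted n (weight c) (weight-≤ c)

  sorted-weight-even : ∀ c → odd (ones (sorted n (weight c))) ≡ false
  sorted-weight-even c = trans (cong odd (ones-sorted-weight c)) (weight-even c)

  word-representative : ∀ c → word (representative c) ≡ sorted n (weight c)
  word-representative c =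
    word-decode (sorted n (weight c)) (sorted-weight-even c) (proj₁ (ends c)) (proj₂ (ends c))

  ones-representative : ∀ c → ones (word (representative c)) ≡ weight c
  ones-representative c = trans (cong ones (word-representative c)) (ones-sorted-weight c)

  at-representative-0 : ∀ c → at (representative c) 0 ≡ proj₁ (ends c)
  at-representative-0 c =
    at-decode-0 (sorted n (weight c)) (sorted-weight-even c) (proj₁ (ends c)) (proj₂ (ends c))

  at-representative-n : ∀ c → at (representative c) n ≡ proj₂ (ends c)
  at-representative-n c =
    at-decode-n (sorted n (weight c)) (sorted-weight-even c) (proj₁ (ends c)) (proj₂ (ends c))

  sorted-extreme-constant : ∀ c {q} → suc q < n →
                            at (sorted n (extreme c)) q ≡ at (sorted n (extreme c)) (suc q)
  sorted-extreme-constant c {q} 1+q<n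
    rewrite at-tab (_<ᵇ extreme c) {q} (<-trans (n<1+n q) 1+q<n) | at-tab (_<ᵇ extreme c) 1+q<n with c
  ... | false = refl
  ... | true  rewrite ≤ᵇ-true (<-trans (n<1+n q) 1+q<n) | ≤ᵇ-true 1+q<n = refl

  extreme-fixed : ∀ e i → move G i (representative (inj₁ e)) ≡ representative (inj₁ e)
  extreme-fixed e@(c , _) i = move-trivial (representative (inj₁ e)) i (begin
    at (word (representative (inj₁ e))) j        ≡⟨ cong (λ w → at w j) (word-representative (inj₁ e)) ⟩
    at (sorted n (extreme c)) j                  ≡⟨ sorted-extreme-constant c (slot-bound (toℕ i)) ⟩
    at (sorted n (extreme c)) (suc j)            ≡⟨ cong (λ w → at w (suc j)) (word-representative (inj₁ e)) ⟨
    at (word (representative (inj₁ e))) (suc j)  ∎)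
    where open ≡-Reasoning
          j = slot (toℕ i)

  weights-equal : ∀ c c′ → representative c ≡ representative c′ → weight c ≡ weight c′
  weights-equal c c′ eq =
    trans (sym (ones-representative c)) (trans (cong (ones ∘ word) eq) (ones-representative c′))

  middle-determined : ∀ i c → weight (inj₂ i) ≡ weight c → inj₂ i ≡ c
  middle-determined i (inj₁ (false , _)) ()
  middle-determined i (inj₁ (true  , _)) w≡n = ⊥-elim (<⇒≢ (s≤s (proj₂ (middle-weight i))) w≡n)
  middle-determined i (inj₂ j)           w≡w =
    cong inj₂ (toℕ-injective (double-injective (suc-injective (suc-injective w≡w))))

  extreme-determined : ∀ e c → representative (inj₁ e) ≡ representative c → inj₁ e ≡ c
  extreme-determined e (inj₂ j) eq =
    sym (middle-determined j (inj₁ e) (sym (weights-equal (inj₁ e) (inj₂ j) eq)))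
  extreme-determined e@(c , _) (inj₁ e′@(c′ , _)) eq =
    cong inj₁ (cong₂ _,_ (extreme-injective c c′ (weights-equal (inj₁ e) (inj₁ e′) eq))
                         (cong₂ _,_ end₀ endₙ))
    where
    extreme-injective : ∀ c c′ → extreme c ≡ extreme c′ → c ≡ c′
    extreme-injective false false _  = refl
    extreme-injective true  true  _  = refl
    extreme-injective false true  ()
    extreme-injective true  false ()
    end₀ : proj₁ (ends (inj₁ e)) ≡ proj₁ (ends (inj₁ e′))
    end₀ = trans (sym (at-representative-0 (inj₁ e)))
                 (trans (cong (λ a → at a 0) eq) (at-representative-0 (inj₁ e′)))
    endₙ : proj₂ (ends (inj₁ e)) ≡ proj₂ (ends (inj₁ e′))
    endₙ = trans (sym (at-representative-n (inj₁ e)))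
                 (trans (cong (λ a → at a n) eq) (at-representative-n (inj₁ e′)))

  separated : ∀ c c′ → Equiv G (representative c) (representative c′) → c ≡ c′
  separated (inj₁ e) c′ c→c′ = extreme-determined e c′ (Equiv-fixed (extreme-fixed e) c→c′)
  separated (inj₂ i) c′ c→c′ = middle-determined i c′
    (trans (sym (ones-representative (inj₂ i))) (trans (ones-invariant c→c′) (ones-representative c′)))

  reach-sorted : ∀ a → Equiv G a (decode (sorted n (ones (word a))) (at a 0) (at a n))
  reach-sorted a =
    subst (λ a′ → Equiv G a′ (decode (sorted n w) (at a 0) (at a n))) (decode-word a)
          (rearrange (word a) (sorted n w) (at a 0) (at a n) (ones-word-even a)
                     (sym (ones-sorted n w (ones-≤ (word a)))))
    where w = ones (word a)

  reach-middle : ∀ i b₀ bₙ →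
                 Equiv G (decode (sorted n (weight (inj₂ i))) b₀ bₙ) (representative (inj₂ i))
  reach-middle i b₀ bₙ = reset-end₀ v b₀ bₙ even 1≤w w≤5+t ◅◅ reset-endₙ v false bₙ even 1≤w w≤5+t
    where
    v = sorted n (weight (inj₂ i))
    even = sorted-weight-even (inj₂ i)
    1≤w = subst (1 ≤_) (sym (ones-sorted-weight (inj₂ i))) (proj₁ (middle-weight i))
    w≤5+t = subst (_≤ 5 + (s + s)) (sym (ones-sorted-weight (inj₂ i))) (proj₂ (middle-weight i))

  n≡3+s+3+s : n ≡ (3 + s) + (3 + s)
  n≡3+s+3+s =
    cong (3 +_) (sym (trans (+-suc s (2 + s)) (cong suc (trans (+-suc s (1 + s)) (cong suc (+-suc s s))))))

  complete : ∀ a → Σ Class λ c → Equiv G a (representative c)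
  complete a with even⇒double (ones (word a)) (ones-word-even a)
  ... | j , w≡j+j = classify j j≤3+s w≡j+j
    where
    j≤3+s : j ≤ 3 + s
    j≤3+s = double-≤-cancel (subst₂ _≤_ w≡j+j n≡3+s+3+s (ones-≤ (word a)))
    reach : ∀ {w} → ones (word a) ≡ w → Equiv G a (decode (sorted n w) (at a 0) (at a n))
    reach refl = reach-sorted a
    classify : ∀ j → j ≤ 3 + s → ones (word a) ≡ j + j → Σ Class λ c → Equiv G a (representative c)
    classify zero    _ w≡0 = inj₁ (false , at a 0 , at a n) , reach w≡0
    classify (suc i) j≤3+s w≡j+j with suc i ≟ 3 + s
    ... | yes refl = inj₁ (true , at a 0 , at a n) , reach (trans w≡j+j (sym n≡3+s+3+s))
    ... | no  j≢3+s = inj₂ k , (reach w≡weight ◅◅ reach-middle k (at a 0) (at a n))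
      where
      i<2+s : i < 2 + s
      i<2+s = ≤-pred (≤∧≢⇒< j≤3+s j≢3+s)
      k : Fin (2 + s)
      k = fromℕ< i<2+s
      w≡weight : ones (word a) ≡ weight (inj₂ k)
      w≡weight =
        trans w≡j+j (trans (cong suc (+-suc i i)) (cong (λ m → 2 + (m + m)) (sym (toℕ-fromℕ< i<2+s))))

  classes : HasExactlyClasses (Dtilde n) (10 + s)
  classes = Representatives-↔ {G = G} Fin↔Class (representative , separated , complete)

proposition2p43 : (k : ℕ) → 3 ≤ k → HasExactlyClasses (Dtilde (2 * k)) (k + 7)
proposition2p43 (suc (suc (suc s))) (s≤s (s≤s (s≤s _))) =
  subst₂ (λ m N → HasExactlyClasses (Dtilde m) N) n≡2*k (cong (3 +_) (+-comm 7 s)) classes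
  where
  open Classification s
  n≡2*k : 6 + (s + s) ≡ 2 * (3 + s)
  n≡2*k = trans n≡3+s+3+s (cong ((3 + s) +_) (sym (+-identityʳ (3 + s))))
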